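{- Let $\alpha\neq 0$ and $\beta$ be complex constants, $\{a_i\},\{b_i\},\{c_i\},\{d_i\}$ ($i\in\mathbb{Z}$) complex sequences (with $b_j,c_j,d_j\neq 0$) and $m,n\ge0$ integers, such that for all $-n\le j\le m$ the quantities $(1-\alpha a_jc_j)(1-\beta a_j/c_j)$, $(1-\alpha a_jd_j)(1-\beta a_j/d_j)$, $(b_j-c_j)(1-\frac{\beta}{\alpha b_jc_j})$, $(b_j-d_j)(1-\frac{\beta}{\alpha b_jd_j})$ are nonzero. Then $$\sum_{k=-n}^{m}(1-\alpha a_kb_k)\Big(1-\beta\frac{a_k}{b_k}\Big)(c_k-d_k)\Big(1-\frac{\beta}{\alpha c_kd_k}\Big)\frac{\prod_{j=1}^{k-1}(1-\alpha a_jc_j)(1-\beta\frac{a_j}{c_j})}{\prod_{j=1}^{k}(1-\alpha a_jd_j)(1-\beta\frac{a_j}{d_j})}\frac{\prod_{j=1}^{k-1}(b_j-d_j)(1-\frac{\beta}{\alpha b_jd_j})}{\prod_{j=1}^{k}(b_j-c_j)(1-\frac{\beta}{\alpha b_jc_j})}$$ $$=\frac{\prod_{j=1}^{m}(1-\alpha a_jc_j)(1-\beta\frac{a_j}{c_j})}{\prod_{j=1}^{m}(1-\alpha a_jd_j)(1-\beta\frac{a_j}{d_j})}\frac{\prod_{j=1}^{m}(b_j-d_j)(1-\frac{\beta}{\alpha b_jd_j})}{\prod_{j=1}^{m}(b_j-c_j)(1-\frac{\beta}{\alpha b_jc_j})}-\frac{\prod_{j=-n}^{0}(1-\alpha a_jd_j)(1-\beta\frac{a_j}{d_j})}{\prod_{j=-n}^{0}(1-\alpha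 a_jc_j)(1-\beta\frac{a_j}{c_j})}\frac{\prod_{j=-n}^{0}(b_j-c_j)(1-\frac{\beta}{\alpha b_jc_j})}{\prod_{j=-n}^{0}(b_j-d_j)(1-\frac{\beta}{\alpha b_jd_j})}.$$
   Context: Products over integer ranges use the convention: for integers $k,m$, $$\prod_{j=k}^{m}A_j=\begin{cases}A_kA_{k+1}\cdots A_m,& m\ge k,\\ 1,& m=k-1,\\ (A_{m+1}A_{m+2}\cdots A_{k-1})^{ -1},& m\le k-2.\end{cases}$$ (The paper denotes the constants $\alpha,\beta$ by $a,b$.) -}

module Defs where

open import Level using (Level; _⊔_) renaming (suc to lsuc)
open import Algebra.Bundles using (CommutativeRing)
open import Data.Nat using (ℕ; zero; suc)
open import Data.Integer using (ℤ; +_; -[1+_]; 1ℤ) renaming (_+_ to _+ℤ_; _-_ to _-ℤ_)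
open import Relation.Nullary using (¬_)

-- A field: a commutative ring with 0 ≠ 1 and a (total) inversion map that
-- is a multiplicative inverse on every nonzero element (value at 0 irrelevant).
record Field (c ℓ : Level) : Set (lsuc (c ⊔ ℓ)) where
  field
    commutativeRing : CommutativeRing c ℓ
  open CommutativeRing commutativeRing public
  infix 8 _⁻¹
  field
    _⁻¹        : Carrier → Carrier
    ⁻¹-inverse : ∀ x → ¬ (x ≈ 0#) → (x * x ⁻¹) ≈ 1#
    0≉1        : ¬ (0# ≈ 1#)

module FieldOps {c ℓ : Level} (F : Field c ℓ) where
  open Field F public

  infixl 7 _/_
  _/_ : Carrier → Carrier → Carrier
  x / y = x * y ⁻¹

  infixl 6 _−_
  _−_ : Carrier → Carrier → Carrier
  x − y = x + (- y)

  prodFrom : (ℤ → Carrier) → ℤ → ℕ → Carrier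
  prodFrom f k zero    = 1#
  prodFrom f k (suc l) = f k * prodFrom f (k +ℤ 1ℤ) l

  -- ∏_{j=k}^{m} f j with the paper's convention for empty / reversed ranges:
  --   m ≥ k     : f k ⋯ f m
  --   m = k - 1 : 1
  --   m ≤ k - 2 : (f (m+1) ⋯ f (k-1))⁻¹
  prodℤ : (ℤ → Carrier) → ℤ → ℤ → Carrier
  prodℤ f k m with (m -ℤ k) +ℤ 1ℤ
  ... | + len     = prodFrom f k len
  ... | -[1+ l ]  = (prodFrom f (m +ℤ 1ℤ) (suc l)) ⁻¹

  sumFrom : (ℤ → Carrier) → ℤ → ℕ → Carrier
  sumFrom f k zero    = 0#
  sumFrom f k (suc l) = f k + sumFrom f (k +ℤ 1ℤ) l

  sumRange : (ℤ → Carrier) → ℕ → ℕ → Carrier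
  sumRange f n m = sumFrom f (Data.Integer.- (+ n)) (suc (n Data.Nat.+ m))

{-# OPTIONS --safe #-}
module Submission where

open import Defs
open import Level using (Level)
open import Algebra.Bundles using (CommutativeRing)
import Algebra.Solver.Ring
import Algebra.Solver.Ring.AlmostCommutativeRing as ACR
open import Data.Empty using (⊥-elim)
open import Data.Maybe using (Maybe; just; nothing)
open import Data.Nat using (ℕ; zero; suc; z≤n) renaming (_+_ to _+ℕ_; _*_ to _*ℕ_)
import Data.Nat.Properties as ℕₚ
open import Data.Integer using (ℤ; +_; -[1+_]; 0ℤ; 1ℤ; _≤_; +≤+; _⊖_; _◃_; +-*-rawRing)
  renaming (_+_ to _+ℤ_; _-_ to _-ℤ_; -_ to negℤ; _*_ to _*ℤ_; _≟_ to _≟ℤ_)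
import Data.Integer.Properties as ℤₚ
open import Data.Integer.Tactic.RingSolver using (solve-∀)
open import Data.Sign using (Sign)
import Relation.Binary.PropositionalEquality as ≡
open ≡ using (_≡_)
open import Relation.Nullary using (¬_; yes; no)

-- With θ(x) = (1 − α a_k x)(1 − β a_k / x) and δ(x, y) = (x − y)(1 − β / (α x y)), the
-- prefactor of the k-th summand is θ(b_k) δ(c_k, d_k), and the three-term identity
--   θ(b) δ(c, d) = θ(c) δ(b, d) − θ(d) δ(b, c)
-- shows that the k-th summand is P(k) − P(k − 1), where P(k) is the first term of the
-- right-hand side with m replaced by k. The sum therefore telescopes to P(m) − P(−n − 1),
-- and the convention ∏_{j=1}^{−n−1} = (∏_{j=−n}^{0})⁻¹ turns P(−n − 1) into the second term.
-- The telescoping only uses that the prefactor has the form u_k p_k − v_k q_k.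

-- The ring solver over an abstract commutative ring needs coefficients with a decidable
-- equality; ℤ is used through its canonical map ι. The optimised _×_ makes ι 1ℤ reduce to 1#,
-- so that con 1ℤ denotes 1# on the nose.
module IntegerCoefficientSolver {c ℓ} (R : CommutativeRing c ℓ) where
  open CommutativeRing R
  open import Algebra.Properties.Ring ring
    using (-‿involutive; -0#≈0#; -‿+-comm; -‿distribˡ-*; -‿distribʳ-*)
  open import Algebra.Properties.Semiring.Mult.TCOptimised semiring using (_×_; 1+×; ×-homo-+; ×1-homo-*)
  open import Relation.Binary.Reasoning.Setoid setoid

  ι : ℤ → Carrier
  ι (+ n)    = n × 1#
  ι -[1+ n ] = - (suc n × 1#)

  private
    x-0≈x : ∀ x → x + - 0# ≈ x
    x-0≈x x = trans (+-congˡ -0#≈0#) (+-identityʳ x)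

    [1+x]-[1+y]≈x-y : ∀ x y → (1# + x) + - (1# + y) ≈ x + - y
    [1+x]-[1+y]≈x-y x y = begin
      (1# + x) + - (1# + y)     ≈⟨ +-congˡ (sym (-‿+-comm 1# y)) ⟩
      (1# + x) + (- 1# + - y)   ≈⟨ +-cong (+-comm 1# x) (+-comm (- 1#) (- y)) ⟩
      (x + 1#) + (- y + - 1#)   ≈⟨ +-assoc x 1# _ ⟩
      x + (1# + (- y + - 1#))   ≈⟨ +-congˡ (+-congˡ (+-comm (- y) (- 1#))) ⟩
      x + (1# + (- 1# + - y))   ≈⟨ +-congˡ (sym (+-assoc 1# (- 1#) (- y))) ⟩
      x + ((1# + - 1#) + - y)   ≈⟨ +-congˡ (+-congʳ (-‿inverseʳ 1#)) ⟩
      x + (0# + - y)            ≈⟨ +-congˡ (+-identityˡ (- y)) ⟩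
      x + - y                   ∎

  ι-⊖ : ∀ m n → ι (m ⊖ n) ≈ m × 1# + - (n × 1#)
  ι-⊖ zero    zero    = sym (x-0≈x 0#)
  ι-⊖ zero    (suc n) = sym (+-identityˡ _)
  ι-⊖ (suc m) zero    = sym (x-0≈x _)
  ι-⊖ (suc m) (suc n) = begin
    ι (suc m ⊖ suc n)               ≡⟨ ≡.cong ι (ℤₚ.[1+m]⊖[1+n]≡m⊖n m n) ⟩
    ι (m ⊖ n)                       ≈⟨ ι-⊖ m n ⟩
    m × 1# + - (n × 1#)             ≈⟨ [1+x]-[1+y]≈x-y _ _ ⟨
    (1# + m × 1#) + - (1# + n × 1#) ≈⟨ +-cong (1+× m 1#) (-‿cong (1+× n 1#)) ⟨
    suc m × 1# + - (suc n × 1#)     ∎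

  ι-+ : ∀ i j → ι (i +ℤ j) ≈ ι i + ι j
  ι-+ (+ m)    (+ n)    = ×-homo-+ 1# m n
  ι-+ (+ m)    -[1+ n ] = ι-⊖ m (suc n)
  ι-+ -[1+ m ] (+ n)    = trans (ι-⊖ n (suc m)) (+-comm _ _)
  ι-+ -[1+ m ] -[1+ n ] = begin
    - (suc (suc (m +ℕ n)) × 1#)       ≡⟨ ≡.cong (λ k → - (suc k × 1#)) (ℕₚ.+-suc m n) ⟨
    - ((suc m +ℕ suc n) × 1#)         ≈⟨ -‿cong (×-homo-+ 1# (suc m) (suc n)) ⟩
    - (suc m × 1# + suc n × 1#)       ≈⟨ -‿+-comm _ _ ⟨
    - (suc m × 1#) + - (suc n × 1#)   ∎

  ι-neg : ∀ i → ι (negℤ i) ≈ - ι i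
  ι-neg (+ zero)  = sym -0#≈0#
  ι-neg (+ suc n) = refl
  ι-neg -[1+ n ]  = sym (-‿involutive _)

  ι-* : ∀ i j → ι (i *ℤ j) ≈ ι i * ι j
  ι-* (+ m) (+ n) = begin
    ι (Sign.+ ◃ m *ℕ n)               ≡⟨ ≡.cong ι (ℤₚ.+◃n≡+n (m *ℕ n)) ⟩
    (m *ℕ n) × 1#                     ≈⟨ ×1-homo-* m n ⟩
    m × 1# * n × 1#                   ∎
  ι-* (+ m) -[1+ n ] = begin
    ι (Sign.- ◃ m *ℕ suc n)           ≡⟨ ≡.cong ι (ℤₚ.-◃n≡-n (m *ℕ suc n)) ⟩
    ι (negℤ (+ (m *ℕ suc n)))         ≈⟨ ι-neg (+ (m *ℕ suc n)) ⟩
    - ((m *ℕ suc n) × 1#)             ≈⟨ -‿cong (×1-homo-* m (suc n)) ⟩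
    - (m × 1# * suc n × 1#)           ≈⟨ -‿distribʳ-* _ _ ⟩
    m × 1# * - (suc n × 1#)           ∎
  ι-* -[1+ m ] (+ n) = begin
    ι (Sign.- ◃ suc m *ℕ n)           ≡⟨ ≡.cong ι (ℤₚ.-◃n≡-n (suc m *ℕ n)) ⟩
    ι (negℤ (+ (suc m *ℕ n)))         ≈⟨ ι-neg (+ (suc m *ℕ n)) ⟩
    - ((suc m *ℕ n) × 1#)             ≈⟨ -‿cong (×1-homo-* (suc m) n) ⟩
    - (suc m × 1# * n × 1#)           ≈⟨ -‿distribˡ-* _ _ ⟩
    - (suc m × 1#) * n × 1#           ∎
  ι-* -[1+ m ] -[1+ n ] = begin
    (suc m *ℕ suc n) × 1#             ≈⟨ ×1-homo-* (suc m) (suc n) ⟩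
    suc m × 1# * suc n × 1#           ≈⟨ -‿involutive _ ⟨
    - - (suc m × 1# * suc n × 1#)     ≈⟨ -‿cong (-‿distribˡ-* _ _) ⟩
    - (- (suc m × 1#) * suc n × 1#)   ≈⟨ -‿distribʳ-* _ _ ⟩
    - (suc m × 1#) * - (suc n × 1#)   ∎

  ι-homomorphism : +-*-rawRing ACR.-Raw-AlmostCommutative⟶ ACR.fromCommutativeRing R
  ι-homomorphism = record
    { ⟦_⟧ = ι ; +-homo = ι-+ ; *-homo = ι-* ; -‿homo = ι-neg ; 0-homo = refl ; 1-homo = refl }

  ι-≟ : ∀ i j → Maybe (ι i ≈ ι j)
  ι-≟ i j with i ≟ℤ j
  ... | yes ≡.refl = just refl
  ... | no _       = nothing

  open Algebra.Solver.Ring +-*-rawRing (ACR.fromCommutativeRing R) ι-homomorphism ι-≟ public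

module FieldProperties {c ℓ} (F : Field c ℓ) where
  open FieldOps F
  open IntegerCoefficientSolver commutativeRing using (solve; _:=_; _:*_; _:-_)
  open import Relation.Binary.Reasoning.Setoid setoid

  1≉0 : ¬ 1# ≈ 0#
  1≉0 1≈0 = 0≉1 (sym 1≈0)

  x*y≉0 : ∀ {x y} → ¬ x ≈ 0# → ¬ y ≈ 0# → ¬ x * y ≈ 0#
  x*y≉0 {x} {y} x≉0 y≉0 xy≈0 = x≉0 (begin
    x                ≈⟨ *-identityʳ x ⟨
    x * 1#           ≈⟨ *-congˡ (⁻¹-inverse y y≉0) ⟨
    x * (y * y ⁻¹)   ≈⟨ *-assoc x y _ ⟨
    x * y * y ⁻¹     ≈⟨ *-congʳ xy≈0 ⟩
    0# * y ⁻¹        ≈⟨ zeroˡ _ ⟩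
    0#               ∎)

  x⁻¹≉0 : ∀ {x} → ¬ x ≈ 0# → ¬ x ⁻¹ ≈ 0#
  x⁻¹≉0 {x} x≉0 x⁻¹≈0 = 0≉1 (begin
    0#          ≈⟨ zeroʳ x ⟨
    x * 0#      ≈⟨ *-congˡ x⁻¹≈0 ⟨
    x * x ⁻¹    ≈⟨ ⁻¹-inverse x x≉0 ⟩
    1#          ∎)

  ⁻¹-inverseˡ : ∀ {x} → ¬ x ≈ 0# → x ⁻¹ * x ≈ 1#
  ⁻¹-inverseˡ {x} x≉0 = trans (*-comm _ x) (⁻¹-inverse x x≉0)

  ⁻¹-unique : ∀ {x y} → ¬ x ≈ 0# → x * y ≈ 1# → x ⁻¹ ≈ y
  ⁻¹-unique {x} {y} x≉0 xy≈1 = begin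
    x ⁻¹              ≈⟨ *-identityʳ _ ⟨
    x ⁻¹ * 1#         ≈⟨ *-congˡ xy≈1 ⟨
    x ⁻¹ * (x * y)    ≈⟨ *-assoc _ x y ⟨
    x ⁻¹ * x * y      ≈⟨ *-congʳ (⁻¹-inverseˡ x≉0) ⟩
    1# * y            ≈⟨ *-identityˡ y ⟩
    y                 ∎

  ⁻¹-cong : ∀ {x y} → ¬ y ≈ 0# → x ≈ y → x ⁻¹ ≈ y ⁻¹
  ⁻¹-cong y≉0 x≈y =
    ⁻¹-unique (λ x≈0 → y≉0 (trans (sym x≈y) x≈0)) (trans (*-congʳ x≈y) (⁻¹-inverse _ y≉0))

  ⁻¹-distrib-* : ∀ {x y} → ¬ x ≈ 0# → ¬ y ≈ 0# → (x * y) ⁻¹ ≈ x ⁻¹ * y ⁻¹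
  ⁻¹-distrib-* {x} {y} x≉0 y≉0 = ⁻¹-unique (x*y≉0 x≉0 y≉0) (begin
    x * y * (x ⁻¹ * y ⁻¹)      ≈⟨ solve 4 (λ x y x' y' → x :* y :* (x' :* y') := x :* x' :* (y :* y'))
                                          refl x y (x ⁻¹) (y ⁻¹) ⟩
    x * x ⁻¹ * (y * y ⁻¹)      ≈⟨ *-cong (⁻¹-inverse x x≉0) (⁻¹-inverse y y≉0) ⟩
    1# * 1#                    ≈⟨ *-identityˡ 1# ⟩
    1#                         ∎)

  ⁻¹-involutive : ∀ {x} → ¬ x ≈ 0# → x ⁻¹ ⁻¹ ≈ x
  ⁻¹-involutive x≉0 = ⁻¹-unique (x⁻¹≉0 x≉0) (⁻¹-inverseˡ x≉0)

  1⁻¹≈1 : 1# ⁻¹ ≈ 1#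
  1⁻¹≈1 = ⁻¹-unique 1≉0 (*-identityˡ 1#)

  [x*y]⁻¹*x≈y⁻¹ : ∀ {x y} → ¬ x * y ≈ 0# → (x * y) ⁻¹ * x ≈ y ⁻¹
  [x*y]⁻¹*x≈y⁻¹ {x} {y} xy≉0 = sym (⁻¹-unique y≉0 (begin
    y * ((x * y) ⁻¹ * x)    ≈⟨ solve 3 (λ y z x → y :* (z :* x) := x :* y :* z) refl y ((x * y) ⁻¹) x ⟩
    x * y * (x * y) ⁻¹      ≈⟨ ⁻¹-inverse _ xy≉0 ⟩
    1#                      ∎))
    where
    y≉0 : ¬ y ≈ 0#
    y≉0 y≈0 = xy≉0 (trans (*-congˡ y≈0) (zeroʳ x))

  x⁻¹/y⁻¹≈y/x : ∀ {x y} → ¬ y ≈ 0# → x ⁻¹ / y ⁻¹ ≈ y / x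
  x⁻¹/y⁻¹≈y/x y≉0 = trans (*-congˡ (⁻¹-involutive y≉0)) (*-comm _ _)

  ratio-difference : ∀ {C₀ C₁ D₀ D₁ P₀ P₁ Q₀ Q₁ x y z w} →
    C₁ ≈ C₀ * x → D₁ ≈ D₀ * y → P₁ ≈ P₀ * z → Q₁ ≈ Q₀ * w →
    ¬ D₀ ≈ 0# → ¬ y ≈ 0# → ¬ Q₀ ≈ 0# → ¬ w ≈ 0# →
    (x * z − y * w) * (C₀ / D₁) * (P₀ / Q₁) ≈ (C₁ / D₁) * (P₁ / Q₁) − (C₀ / D₀) * (P₀ / Q₀)
  ratio-difference {C₀} {C₁} {D₀} {D₁} {P₀} {P₁} {Q₀} {Q₁} {x} {y} {z} {w}
                   C₁≈ D₁≈ P₁≈ Q₁≈ D₀≉0 y≉0 Q₀≉0 w≉0 = begin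
    (x * z − y * w) * (C₀ * D₁ ⁻¹) * (P₀ * Q₁ ⁻¹)
      ≈⟨ *-cong (*-congˡ (*-congˡ D₁⁻¹≈)) (*-congˡ Q₁⁻¹≈) ⟩
    (x * z − y * w) * (C₀ * (D₀ ⁻¹ * y ⁻¹)) * (P₀ * (Q₀ ⁻¹ * w ⁻¹))
      ≈⟨ solve 10 (λ x y z w C₀ D₀' y' P₀ Q₀' w' →
           (x :* z :- y :* w) :* (C₀ :* (D₀' :* y')) :* (P₀ :* (Q₀' :* w'))
           := C₀ :* x :* (D₀' :* y') :* (P₀ :* z :* (Q₀' :* w'))
              :- C₀ :* D₀' :* (P₀ :* Q₀') :* (y :* y' :* (w :* w')))
           refl x y z w C₀ (D₀ ⁻¹) (y ⁻¹) P₀ (Q₀ ⁻¹) (w ⁻¹) ⟩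
    C₀ * x * (D₀ ⁻¹ * y ⁻¹) * (P₀ * z * (Q₀ ⁻¹ * w ⁻¹))
      − C₀ * D₀ ⁻¹ * (P₀ * Q₀ ⁻¹) * (y * y ⁻¹ * (w * w ⁻¹))
      ≈⟨ +-cong (*-cong (*-cong (sym C₁≈) (sym D₁⁻¹≈)) (*-cong (sym P₁≈) (sym Q₁⁻¹≈)))
                (-‿cong (*-congˡ (trans (*-cong (⁻¹-inverse y y≉0) (⁻¹-inverse w w≉0)) (*-identityˡ 1#)))) ⟩
    C₁ * D₁ ⁻¹ * (P₁ * Q₁ ⁻¹) − C₀ * D₀ ⁻¹ * (P₀ * Q₀ ⁻¹) * 1#
      ≈⟨ +-congˡ (-‿cong (*-identityʳ _)) ⟩
    C₁ * D₁ ⁻¹ * (P₁ * Q₁ ⁻¹) − C₀ * D₀ ⁻¹ * (P₀ * Q₀ ⁻¹) ∎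
    where
    D₁⁻¹≈ : D₁ ⁻¹ ≈ D₀ ⁻¹ * y ⁻¹
    D₁⁻¹≈ = trans (⁻¹-cong (x*y≉0 D₀≉0 y≉0) D₁≈) (⁻¹-distrib-* D₀≉0 y≉0)
    Q₁⁻¹≈ : Q₁ ⁻¹ ≈ Q₀ ⁻¹ * w ⁻¹
    Q₁⁻¹≈ = trans (⁻¹-cong (x*y≉0 Q₀≉0 w≉0) Q₁≈) (⁻¹-distrib-* Q₀≉0 w≉0)

module ThreeTermIdentity {c ℓ} (F : Field c ℓ) where
  open FieldOps F
  open FieldProperties F
  open IntegerCoefficientSolver commutativeRing using (solve; _:=_; _:+_; _:*_; _:-_; con)
  open import Relation.Binary.Reasoning.Setoid setoid

  θ : (α β a x : Carrier) → Carrier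
  θ α β a x = (1# − α * a * x) * (1# − β * a / x)

  δ : (α β x y : Carrier) → Carrier
  δ α β x y = (x − y) * (1# − β / (α * x * y))

  [1-ux][1-vx⁻¹]≈ : ∀ u v {x} → ¬ x ≈ 0# →
    (1# − u * x) * (1# − v * x ⁻¹) ≈ 1# + u * v − u * x − v * x ⁻¹
  [1-ux][1-vx⁻¹]≈ u v {x} x≉0 = begin
    (1# − u * x) * (1# − v * x ⁻¹)
      ≈⟨ solve 4 (λ u v x x' → (con 1ℤ :- u :* x) :* (con 1ℤ :- v :* x')
                               := con 1ℤ :+ u :* v :* (x :* x') :- u :* x :- v :* x')
                 refl u v x (x ⁻¹) ⟩
    1# + u * v * (x * x ⁻¹) − u * x − v * x ⁻¹
      ≈⟨ +-congʳ (+-congʳ (+-congˡ (trans (*-congˡ (⁻¹-inverse x x≉0)) (*-identityʳ _)))) ⟩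
    1# + u * v − u * x − v * x ⁻¹ ∎

  [x-y][1-γx⁻¹y⁻¹]≈ : ∀ γ {x y} → ¬ x ≈ 0# → ¬ y ≈ 0# →
    (x − y) * (1# − γ * (x ⁻¹ * y ⁻¹)) ≈ x − y + γ * (x ⁻¹ − y ⁻¹)
  [x-y][1-γx⁻¹y⁻¹]≈ γ {x} {y} x≉0 y≉0 = begin
    (x − y) * (1# − γ * (x ⁻¹ * y ⁻¹))
      ≈⟨ solve 5 (λ γ x y x' y' → (x :- y) :* (con 1ℤ :- γ :* (x' :* y'))
                                  := x :- y :+ γ :* (x' :* (y :* y') :- y' :* (x :* x')))
                 refl γ x y (x ⁻¹) (y ⁻¹) ⟩
    x − y + γ * (x ⁻¹ * (y * y ⁻¹) − y ⁻¹ * (x * x ⁻¹))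
      ≈⟨ +-congˡ (*-congˡ (+-cong (cancel y≉0) (-‿cong (cancel x≉0)))) ⟩
    x − y + γ * (x ⁻¹ − y ⁻¹) ∎
    where
    cancel : ∀ {z w} → ¬ z ≈ 0# → w * (z * z ⁻¹) ≈ w
    cancel {z} z≉0 = trans (*-congˡ (⁻¹-inverse z z≉0)) (*-identityʳ _)

  -- With γ = β / α, so that β a = (α a) γ, and x x⁻¹ = 1, θ and δ become the polynomials L and M
  -- in x and x⁻¹; the identity then holds with x and x⁻¹ treated as independent variables.
  three-term-identity : ∀ {α} β a {b c d} → ¬ α ≈ 0# → ¬ b ≈ 0# → ¬ c ≈ 0# → ¬ d ≈ 0# →
    θ α β a b * δ α β c d ≈ θ α β a c * δ α β b d − θ α β a d * δ α β b c
  three-term-identity {α} β a {b} {c} {d} α≉0 b≉0 c≉0 d≉0 = begin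
    θ α β a b * δ α β c d
      ≈⟨ *-cong (θ≈L b≉0) (δ≈M c≉0 d≉0) ⟩
    L b * M c d
      ≈⟨ solve 8 (λ u γ b b' c c' d d' →
           let L : _ → _ → _
               L x x' = con 1ℤ :+ u :* (u :* γ) :- u :* x :- u :* γ :* x'
               M : _ → _ → _ → _ → _
               M x x' y y' = x :- y :+ γ :* (x' :- y')
           in L b b' :* M c c' d d' := L c c' :* M b b' d d' :- L d d' :* M b b' c c')
         refl u γ b (b ⁻¹) c (c ⁻¹) d (d ⁻¹) ⟩
    L c * M b d − L d * M b c
      ≈⟨ +-cong (*-cong (θ≈L c≉0) (δ≈M b≉0 d≉0)) (-‿cong (*-cong (θ≈L d≉0) (δ≈M b≉0 c≉0))) ⟨
    θ α β a c * δ α β b d − θ α β a d * δ α β b c ∎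
    where
    u γ : Carrier
    u = α * a
    γ = β / α

    L : Carrier → Carrier
    L x = 1# + u * (u * γ) − u * x − u * γ * x ⁻¹

    M : Carrier → Carrier → Carrier
    M x y = x − y + γ * (x ⁻¹ − y ⁻¹)

    βa≈uγ : β * a ≈ u * γ
    βa≈uγ = begin
      β * a                   ≈⟨ *-identityʳ _ ⟨
      β * a * 1#              ≈⟨ *-congˡ (⁻¹-inverse α α≉0) ⟨
      β * a * (α * α ⁻¹)      ≈⟨ solve 4 (λ β a α α' → β :* a :* (α :* α') := α :* a :* (β :* α'))
                                        refl β a α (α ⁻¹) ⟩
      u * γ                   ∎

    θ≈L : ∀ {x} → ¬ x ≈ 0# → θ α β a x ≈ L x
    θ≈L {x} x≉0 = begin
      θ α β a x                                 ≈⟨ [1-ux][1-vx⁻¹]≈ u (β * a) x≉0 ⟩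
      1# + u * (β * a) − u * x − β * a * x ⁻¹   ≈⟨ +-cong (+-congʳ (+-congˡ (*-congˡ βa≈uγ)))
                                                          (-‿cong (*-congʳ βa≈uγ)) ⟩
      L x                                       ∎

    δ≈M : ∀ {x y} → ¬ x ≈ 0# → ¬ y ≈ 0# → δ α β x y ≈ M x y
    δ≈M {x} {y} x≉0 y≉0 = begin
      δ α β x y                                 ≈⟨ *-congˡ (+-congˡ (-‿cong (*-congˡ [αxy]⁻¹≈))) ⟩
      (x − y) * (1# − β * (α ⁻¹ * (x ⁻¹ * y ⁻¹)))
                                                ≈⟨ *-congˡ (+-congˡ (-‿cong (*-assoc β _ _))) ⟨
      (x − y) * (1# − γ * (x ⁻¹ * y ⁻¹))        ≈⟨ [x-y][1-γx⁻¹y⁻¹]≈ γ x≉0 y≉0 ⟩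
      M x y                                     ∎
      where
      [αxy]⁻¹≈ : (α * x * y) ⁻¹ ≈ α ⁻¹ * (x ⁻¹ * y ⁻¹)
      [αxy]⁻¹≈ = begin
        (α * x * y) ⁻¹          ≈⟨ ⁻¹-cong (x*y≉0 α≉0 (x*y≉0 x≉0 y≉0)) (*-assoc α x y) ⟩
        (α * (x * y)) ⁻¹        ≈⟨ ⁻¹-distrib-* α≉0 (x*y≉0 x≉0 y≉0) ⟩
        α ⁻¹ * (x * y) ⁻¹       ≈⟨ *-congˡ (⁻¹-distrib-* x≉0 y≉0) ⟩
        α ⁻¹ * (x ⁻¹ * y ⁻¹)    ∎

module IndexArithmetic where

  [k-1]+1≡k : ∀ k → (k -ℤ 1ℤ) +ℤ 1ℤ ≡ k
  [k-1]+1≡k = solve-∀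

  [k+1]-1≡k : ∀ k → (k +ℤ 1ℤ) -ℤ 1ℤ ≡ k
  [k+1]-1≡k = solve-∀

  k+[1+l]-1≡k+l : ∀ k l → k +ℤ + suc l -ℤ 1ℤ ≡ k +ℤ + l
  k+[1+l]-1≡k+l k l = lemma k (+ l)
    where
    lemma : ∀ k x → k +ℤ (1ℤ +ℤ x) -ℤ 1ℤ ≡ k +ℤ x
    lemma = solve-∀

  [k+1]+l-1≡k+[1+l]-1 : ∀ k l → (k +ℤ 1ℤ) +ℤ + l -ℤ 1ℤ ≡ k +ℤ + suc l -ℤ 1ℤ
  [k+1]+l-1≡k+[1+l]-1 k l = ≡.cong (_-ℤ 1ℤ) (ℤₚ.+-assoc k 1ℤ (+ l))

  k≤k+[1+l]-1 : ∀ k l → k ≤ k +ℤ + suc l -ℤ 1ℤ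
  k≤k+[1+l]-1 k l = ℤₚ.≤-trans (ℤₚ.i≤i+j k (+ l)) (ℤₚ.≤-reflexive (≡.sym (k+[1+l]-1≡k+l k l)))

  -- prodℤ f i k branches on the length (k − i) + 1 of the range [i, k].
  length-pred : ∀ i k → ((k -ℤ 1ℤ) -ℤ i) +ℤ 1ℤ ≡ ((k -ℤ i) +ℤ 1ℤ) -ℤ 1ℤ
  length-pred = solve-∀

  length-reversed : ∀ i k → ((i -ℤ 1ℤ) -ℤ k) +ℤ 1ℤ ≡ negℤ (((k -ℤ 1ℤ) -ℤ i) +ℤ 1ℤ)
  length-reversed = solve-∀

  length≡difference : ∀ i k → i -ℤ k ≡ ((i -ℤ 1ℤ) -ℤ k) +ℤ 1ℤ
  length≡difference = solve-∀

  last-index : ∀ i k → i +ℤ ((k -ℤ i) +ℤ 1ℤ) -ℤ 1ℤ ≡ k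
  last-index = solve-∀

  last-index-reversed : ∀ i k → (k +ℤ 1ℤ) +ℤ negℤ ((k -ℤ i) +ℤ 1ℤ) -ℤ 1ℤ ≡ i -ℤ 1ℤ
  last-index-reversed = solve-∀

  snoc-index : ∀ i k → i +ℤ (((k -ℤ i) +ℤ 1ℤ) -ℤ 1ℤ) ≡ k
  snoc-index = solve-∀

  -n+[1+n+m]-1≡m : ∀ n m → negℤ (+ n) +ℤ + suc (n +ℕ m) -ℤ 1ℤ ≡ + m
  -n+[1+n+m]-1≡m n m =
    ≡.trans (≡.cong (λ s → negℤ (+ n) +ℤ (1ℤ +ℤ s) -ℤ 1ℤ) (ℤₚ.pos-+ n m)) (lemma (+ n) (+ m))
    where
    lemma : ∀ x y → negℤ x +ℤ (1ℤ +ℤ (x +ℤ y)) -ℤ 1ℤ ≡ y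
    lemma = solve-∀

  -[1+l]-1≡-[2+l] : ∀ l → -[1+ l ] -ℤ 1ℤ ≡ -[1+ suc l ]
  -[1+l]-1≡-[2+l] l = ≡.cong (λ x → -[1+ suc x ]) (ℕₚ.+-identityʳ l)

OnInterval : ∀ {p} → (ℤ → Set p) → ℤ → ℤ → Set p
OnInterval P lo hi = ∀ j → lo ≤ j → j ≤ hi → P j

OnInterval-mono : ∀ {p} {P : ℤ → Set p} {lo hi lo′ hi′} →
  lo ≤ lo′ → hi′ ≤ hi → OnInterval P lo hi → OnInterval P lo′ hi′
OnInterval-mono lo≤lo′ hi′≤hi P-on j lo′≤j j≤hi′ =
  P-on j (ℤₚ.≤-trans lo≤lo′ lo′≤j) (ℤₚ.≤-trans j≤hi′ hi′≤hi)

module Products {c ℓ} (F : Field c ℓ) where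
  open FieldOps F
  open FieldProperties F
  open IntegerCoefficientSolver commutativeRing using (solve; _:=_; _:+_; _:-_)
  open IndexArithmetic
  open import Relation.Binary.Reasoning.Setoid setoid

  NonzeroOn : (ℤ → Carrier) → ℤ → ℤ → Set ℓ
  NonzeroOn f = OnInterval (λ j → ¬ f j ≈ 0#)

  prodFrom-snoc : ∀ f k l → prodFrom f k (suc l) ≈ prodFrom f k l * f (k +ℤ + l)
  prodFrom-snoc f k zero = begin
    f k * 1#          ≈⟨ *-comm _ 1# ⟩
    1# * f k          ≡⟨ ≡.cong (λ j → 1# * f j) (ℤₚ.+-identityʳ k) ⟨
    1# * f (k +ℤ + 0) ∎
  prodFrom-snoc f k (suc l) = begin
    f k * prodFrom f (k +ℤ 1ℤ) (suc l)                   ≈⟨ *-congˡ (prodFrom-snoc f (k +ℤ 1ℤ) l) ⟩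
    f k * (prodFrom f (k +ℤ 1ℤ) l * f (k +ℤ 1ℤ +ℤ + l))   ≈⟨ *-assoc _ _ _ ⟨
    f k * prodFrom f (k +ℤ 1ℤ) l * f (k +ℤ 1ℤ +ℤ + l)     ≡⟨ ≡.cong (λ j → P * f j) (ℤₚ.+-assoc k 1ℤ (+ l)) ⟩
    f k * prodFrom f (k +ℤ 1ℤ) l * f (k +ℤ + suc l)       ∎
    where
    P : Carrier
    P = f k * prodFrom f (k +ℤ 1ℤ) l

  prodFrom-nonzero : ∀ f k len → NonzeroOn f k (k +ℤ + len -ℤ 1ℤ) → ¬ prodFrom f k len ≈ 0#
  prodFrom-nonzero f k zero    _    = 1≉0
  prodFrom-nonzero f k (suc l) f≉0 = x*y≉0
    (f≉0 k ℤₚ.≤-refl (k≤k+[1+l]-1 k l))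
    (prodFrom-nonzero f (k +ℤ 1ℤ) l
      (OnInterval-mono (ℤₚ.i≤i+j k 1ℤ) (ℤₚ.≤-reflexive ([k+1]+l-1≡k+[1+l]-1 k l)) f≉0))

  prodℤ-nonneg : ∀ f i k {len} → (k -ℤ i) +ℤ 1ℤ ≡ + len → prodℤ f i k ≡ prodFrom f i len
  prodℤ-nonneg f i k eq with (k -ℤ i) +ℤ 1ℤ | eq
  ... | + _ | ≡.refl = ≡.refl

  prodℤ-neg : ∀ f i k {l} → (k -ℤ i) +ℤ 1ℤ ≡ -[1+ l ] → prodℤ f i k ≡ (prodFrom f (k +ℤ 1ℤ) (suc l)) ⁻¹
  prodℤ-neg f i k eq with (k -ℤ i) +ℤ 1ℤ | eq
  ... | -[1+ _ ] | ≡.refl = ≡.refl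

  -- Only one of the two ranges is nonempty: [i, k] if prodℤ f i k is a genuine product,
  -- [k + 1, i − 1] if it is an inverted one.
  prodℤ-nonzero : ∀ f i k → NonzeroOn f i k → NonzeroOn f (k +ℤ 1ℤ) (i -ℤ 1ℤ) → ¬ prodℤ f i k ≈ 0#
  prodℤ-nonzero f i k f≉0 f≉0′ with (k -ℤ i) +ℤ 1ℤ in eq
  ... | + len =
    prodFrom-nonzero f i len (OnInterval-mono ℤₚ.≤-refl (ℤₚ.≤-reflexive last) f≉0)
    where
    last : i +ℤ + len -ℤ 1ℤ ≡ k
    last = ≡.trans (≡.cong (λ e → i +ℤ e -ℤ 1ℤ) (≡.sym eq)) (last-index i k)
  ... | -[1+ l ] =
    x⁻¹≉0 (prodFrom-nonzero f (k +ℤ 1ℤ) (suc l) (OnInterval-mono ℤₚ.≤-refl (ℤₚ.≤-reflexive last) f≉0′))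
    where
    last : k +ℤ 1ℤ +ℤ + suc l -ℤ 1ℤ ≡ i -ℤ 1ℤ
    last = ≡.trans (≡.cong (λ e → k +ℤ 1ℤ +ℤ negℤ e -ℤ 1ℤ) (≡.sym eq)) (last-index-reversed i k)

  private
    prodℤ-snoc-reversed : ∀ f i k {L} → NonzeroOn f k (i -ℤ 1ℤ) → ((k -ℤ 1ℤ) -ℤ i) +ℤ 1ℤ ≡ -[1+ L ] →
      prodℤ f i (k -ℤ 1ℤ) * f k ≈ (prodFrom f (k +ℤ 1ℤ) L) ⁻¹
    prodℤ-snoc-reversed f i k {L} f≉0 eq = begin
      prodℤ f i (k -ℤ 1ℤ) * f k
        ≡⟨ ≡.cong (_* f k) (prodℤ-neg f i (k -ℤ 1ℤ) eq) ⟩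
      (prodFrom f (k -ℤ 1ℤ +ℤ 1ℤ) (suc L)) ⁻¹ * f k
        ≡⟨ ≡.cong (λ s → (prodFrom f s (suc L)) ⁻¹ * f k) ([k-1]+1≡k k) ⟩
      (f k * prodFrom f (k +ℤ 1ℤ) L) ⁻¹ * f k
        ≈⟨ [x*y]⁻¹*x≈y⁻¹ (prodFrom-nonzero f k (suc L) (OnInterval-mono ℤₚ.≤-refl (ℤₚ.≤-reflexive last) f≉0)) ⟩
      (prodFrom f (k +ℤ 1ℤ) L) ⁻¹
        ∎
      where
      last : k +ℤ + suc L -ℤ 1ℤ ≡ i -ℤ 1ℤ
      last = ≡.trans (≡.cong₂ (λ s e → s +ℤ negℤ e -ℤ 1ℤ) (≡.sym ([k-1]+1≡k k)) (≡.sym eq))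
                     (last-index-reversed i (k -ℤ 1ℤ))

  prodℤ-snoc : ∀ f i k → NonzeroOn f k (i -ℤ 1ℤ) → prodℤ f i k ≈ prodℤ f i (k -ℤ 1ℤ) * f k
  prodℤ-snoc f i k f≉0 with (k -ℤ i) +ℤ 1ℤ in eq
  ... | + suc l = begin
    prodFrom f i (suc l)             ≈⟨ prodFrom-snoc f i l ⟩
    prodFrom f i l * f (i +ℤ + l)    ≡⟨ ≡.cong₂ _*_ (≡.sym (prodℤ-nonneg f i (k -ℤ 1ℤ) length′)) (≡.cong f i+l≡k) ⟩
    prodℤ f i (k -ℤ 1ℤ) * f k        ∎
    where
    length′ : ((k -ℤ 1ℤ) -ℤ i) +ℤ 1ℤ ≡ + l
    length′ = ≡.trans (length-pred i k) (≡.cong (_-ℤ 1ℤ) eq)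
    i+l≡k : i +ℤ + l ≡ k
    i+l≡k = ≡.trans (≡.cong (λ e → i +ℤ (e -ℤ 1ℤ)) (≡.sym eq)) (snoc-index i k)
  ... | + zero = begin
    1#                               ≈⟨ 1⁻¹≈1 ⟨
    (prodFrom f (k +ℤ 1ℤ) 0) ⁻¹      ≈⟨ prodℤ-snoc-reversed f i k f≉0 length′ ⟨
    prodℤ f i (k -ℤ 1ℤ) * f k        ∎
    where
    length′ : ((k -ℤ 1ℤ) -ℤ i) +ℤ 1ℤ ≡ -[1+ 0 ]
    length′ = ≡.trans (length-pred i k) (≡.cong (_-ℤ 1ℤ) eq)
  ... | -[1+ l ] = sym (prodℤ-snoc-reversed f i k f≉0
    (≡.trans (length-pred i k) (≡.trans (≡.cong (_-ℤ 1ℤ) eq) (-[1+l]-1≡-[2+l] l))))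

  prodℤ-reversed : ∀ f {i k} → k ≤ i → prodℤ f i (k -ℤ 1ℤ) ≈ (prodℤ f k (i -ℤ 1ℤ)) ⁻¹
  prodℤ-reversed f {i} {k} k≤i with ((i -ℤ 1ℤ) -ℤ k) +ℤ 1ℤ in eq
  ... | + zero = trans (reflexive (prodℤ-nonneg f i (k -ℤ 1ℤ) length′)) (sym 1⁻¹≈1)
    where
    length′ : ((k -ℤ 1ℤ) -ℤ i) +ℤ 1ℤ ≡ + 0
    length′ = ≡.trans (length-reversed k i) (≡.cong negℤ eq)
  ... | + suc l = reflexive (≡.trans (prodℤ-neg f i (k -ℤ 1ℤ) length′)
                                     (≡.cong (λ s → (prodFrom f s (suc l)) ⁻¹) ([k-1]+1≡k k)))
    where
    length′ : ((k -ℤ 1ℤ) -ℤ i) +ℤ 1ℤ ≡ -[1+ l ]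
    length′ = ≡.trans (length-reversed k i) (≡.cong negℤ eq)
  ... | -[1+ l ] =
    ⊥-elim (0≰-[1+l] (≡.subst (0ℤ ≤_) (≡.trans (length≡difference i k) eq) (ℤₚ.i≤j⇒0≤j-i k≤i)))
    where
    0≰-[1+l] : ¬ 0ℤ ≤ -[1+ l ]
    0≰-[1+l] ()

  sumFrom-telescope : ∀ (g Q : ℤ → Carrier) k l →
    OnInterval (λ j → g j ≈ Q j − Q (j -ℤ 1ℤ)) k (k +ℤ + l -ℤ 1ℤ) →
    sumFrom g k l ≈ Q (k +ℤ + l -ℤ 1ℤ) − Q (k -ℤ 1ℤ)
  sumFrom-telescope g Q k zero _ = begin
    0#                                ≈⟨ -‿inverseʳ _ ⟨
    Q (k -ℤ 1ℤ) − Q (k -ℤ 1ℤ)         ≡⟨ ≡.cong (λ s → Q (s -ℤ 1ℤ) − Q (k -ℤ 1ℤ)) (ℤₚ.+-identityʳ k) ⟨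
    Q (k +ℤ + 0 -ℤ 1ℤ) − Q (k -ℤ 1ℤ)  ∎
  sumFrom-telescope g Q k (suc l) g≈ = begin
    g k + sumFrom g (k +ℤ 1ℤ) l
      ≈⟨ +-cong (g≈ k ℤₚ.≤-refl (k≤k+[1+l]-1 k l))
                (sumFrom-telescope g Q (k +ℤ 1ℤ) l
                  (OnInterval-mono (ℤₚ.i≤i+j k 1ℤ) (ℤₚ.≤-reflexive ([k+1]+l-1≡k+[1+l]-1 k l)) g≈)) ⟩
    (Q k − Q (k -ℤ 1ℤ)) + (Q (k +ℤ 1ℤ +ℤ + l -ℤ 1ℤ) − Q (k +ℤ 1ℤ -ℤ 1ℤ))
      ≡⟨ ≡.cong₂ (λ s t → (Q k − Q (k -ℤ 1ℤ)) + (Q s − Q t)) ([k+1]+l-1≡k+[1+l]-1 k l) ([k+1]-1≡k k) ⟩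
    (Q k − Q (k -ℤ 1ℤ)) + (Q (k +ℤ + suc l -ℤ 1ℤ) − Q k)
      ≈⟨ solve 3 (λ a b c → (a :- b) :+ (c :- a) := c :- b) refl (Q k) (Q (k -ℤ 1ℤ)) (Q (k +ℤ + suc l -ℤ 1ℤ)) ⟩
    Q (k +ℤ + suc l -ℤ 1ℤ) − Q (k -ℤ 1ℤ) ∎

  sumRange-telescope : ∀ (g Q : ℤ → Carrier) n m →
    OnInterval (λ j → g j ≈ Q j − Q (j -ℤ 1ℤ)) (negℤ (+ n)) (+ m) →
    sumRange g n m ≈ Q (+ m) − Q (negℤ (+ n) -ℤ 1ℤ)
  sumRange-telescope g Q n m g≈ = begin
    sumFrom g (negℤ (+ n)) (suc (n +ℕ m))
      ≈⟨ sumFrom-telescope g Q (negℤ (+ n)) (suc (n +ℕ m))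
           (≡.subst (OnInterval _ (negℤ (+ n))) (≡.sym (-n+[1+n+m]-1≡m n m)) g≈) ⟩
    Q (negℤ (+ n) +ℤ + suc (n +ℕ m) -ℤ 1ℤ) − Q (negℤ (+ n) -ℤ 1ℤ)
      ≡⟨ ≡.cong (λ s → Q s − Q (negℤ (+ n) -ℤ 1ℤ)) (-n+[1+n+m]-1≡m n m) ⟩
    Q (+ m) − Q (negℤ (+ n) -ℤ 1ℤ) ∎

module RatioTelescope {c ℓ} (F : Field c ℓ) where
  open FieldOps F
  open FieldProperties F
  open Products F
  open IndexArithmetic using ([k-1]+1≡k)

  module _ (u v p q : ℤ → Carrier) (n m : ℕ)
           (u≉0 : NonzeroOn u (negℤ (+ n)) (+ m)) (v≉0 : NonzeroOn v (negℤ (+ n)) (+ m))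
           (p≉0 : NonzeroOn p (negℤ (+ n)) (+ m)) (q≉0 : NonzeroOn q (negℤ (+ n)) (+ m)) where

    ratio : ℤ → Carrier
    ratio k = (prodℤ u 1ℤ k / prodℤ v 1ℤ k) * (prodℤ p 1ℤ k / prodℤ q 1ℤ k)

    summand : (ℤ → Carrier) → ℤ → Carrier
    summand t k = t k * (prodℤ u 1ℤ (k -ℤ 1ℤ) / prodℤ v 1ℤ k) * (prodℤ p 1ℤ (k -ℤ 1ℤ) / prodℤ q 1ℤ k)

    private
      within : ∀ f → NonzeroOn f (negℤ (+ n)) (+ m) →
               ∀ {lo hi} → negℤ (+ n) ≤ lo → hi ≤ + m → NonzeroOn f lo hi
      within f f≉0 lo≤ ≤hi = OnInterval-mono lo≤ ≤hi f≉0

      0≤m : 0ℤ ≤ + m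
      0≤m = +≤+ z≤n

      -n≤1 : negℤ (+ n) ≤ 1ℤ
      -n≤1 = ℤₚ.neg-≤-pos

    ratio-step : ∀ t → OnInterval (λ k → t k ≈ u k * p k − v k * q k) (negℤ (+ n)) (+ m) →
      OnInterval (λ k → summand t k ≈ ratio k − ratio (k -ℤ 1ℤ)) (negℤ (+ n)) (+ m)
    ratio-step t t≈ k -n≤k k≤m =
      trans (*-congʳ (*-congʳ (t≈ k -n≤k k≤m)))
            (ratio-difference (snoc u u≉0) (snoc v v≉0) (snoc p p≉0) (snoc q q≉0)
                              (below v v≉0) (v≉0 k -n≤k k≤m) (below q q≉0) (q≉0 k -n≤k k≤m))
      where
      snoc : ∀ f → NonzeroOn f (negℤ (+ n)) (+ m) → prodℤ f 1ℤ k ≈ prodℤ f 1ℤ (k -ℤ 1ℤ) * f k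
      snoc f f≉0 = prodℤ-snoc f 1ℤ k (within f f≉0 -n≤k 0≤m)

      below : ∀ f → NonzeroOn f (negℤ (+ n)) (+ m) → ¬ prodℤ f 1ℤ (k -ℤ 1ℤ) ≈ 0#
      below f f≉0 = prodℤ-nonzero f 1ℤ (k -ℤ 1ℤ)
        (within f f≉0 -n≤1 (ℤₚ.≤-trans (ℤₚ.i-j≤i k 1ℤ) k≤m))
        (within f f≉0 (≡.subst (negℤ (+ n) ≤_) (≡.sym ([k-1]+1≡k k)) -n≤k) 0≤m)

    ratio-below : ratio (negℤ (+ n) -ℤ 1ℤ) ≈
      (prodℤ v (negℤ (+ n)) 0ℤ / prodℤ u (negℤ (+ n)) 0ℤ)
      * (prodℤ q (negℤ (+ n)) 0ℤ / prodℤ p (negℤ (+ n)) 0ℤ)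
    ratio-below = *-cong (reversed u v v≉0) (reversed p q q≉0)
      where
      reversed : ∀ f g → NonzeroOn g (negℤ (+ n)) (+ m) →
        prodℤ f 1ℤ (negℤ (+ n) -ℤ 1ℤ) / prodℤ g 1ℤ (negℤ (+ n) -ℤ 1ℤ)
          ≈ prodℤ g (negℤ (+ n)) 0ℤ / prodℤ f (negℤ (+ n)) 0ℤ
      reversed f g g≉0 = trans
        (*-cong (prodℤ-reversed f -n≤1) (⁻¹-cong (x⁻¹≉0 G≉0) (prodℤ-reversed g -n≤1)))
        (x⁻¹/y⁻¹≈y/x G≉0)
        where
        G≉0 : ¬ prodℤ g (negℤ (+ n)) 0ℤ ≈ 0#
        G≉0 = prodℤ-nonzero g (negℤ (+ n)) 0ℤ (within g g≉0 ℤₚ.≤-refl 0≤m)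
          (within g g≉0 -n≤1 (ℤₚ.≤-trans (ℤₚ.i-j≤i (negℤ (+ n)) 1ℤ) (ℤₚ.neg-≤-pos {n} {m})))

    ratio-telescope : ∀ t → OnInterval (λ k → t k ≈ u k * p k − v k * q k) (negℤ (+ n)) (+ m) →
      sumRange (summand t) n m
      ≈ (prodℤ u 1ℤ (+ m) / prodℤ v 1ℤ (+ m)) * (prodℤ p 1ℤ (+ m) / prodℤ q 1ℤ (+ m))
        − (prodℤ v (negℤ (+ n)) 0ℤ / prodℤ u (negℤ (+ n)) 0ℤ)
          * (prodℤ q (negℤ (+ n)) 0ℤ / prodℤ p (negℤ (+ n)) 0ℤ)
    ratio-telescope t t≈ =
      trans (sumRange-telescope (summand t) ratio n m (ratio-step t t≈)) (+-congˡ (-‿cong ratio-below))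

corollary3p5 : {c ℓ : Level} (F : Field c ℓ) → let open FieldOps F in
  (α β : Carrier) (a b cs d : ℤ → Carrier) (m n : ℕ) →
  ¬ (α ≈ 0#) →
  (∀ j → ¬ (b j ≈ 0#)) → (∀ j → ¬ (cs j ≈ 0#)) → (∀ j → ¬ (d j ≈ 0#)) →
  (∀ j → negℤ (+ n) ≤ j → j ≤ + m →
    ¬ (((1# − α * a j * cs j) * (1# − β * a j / cs j)) ≈ 0#)) →
  (∀ j → negℤ (+ n) ≤ j → j ≤ + m →
    ¬ (((1# − α * a j * d j) * (1# − β * a j / d j)) ≈ 0#)) →
  (∀ j → negℤ (+ n) ≤ j → j ≤ + m →
    ¬ (((b j − cs j) * (1# − β / (α * b j * cs j))) ≈ 0#)) →
  (∀ j → negℤ (+ n) ≤ j → j ≤ + m →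
    ¬ (((b j − d j) * (1# − β / (α * b j * d j))) ≈ 0#)) →
  sumRange
    (λ k → (1# − α * a k * b k) * (1# − β * a k / b k)
           * (cs k − d k) * (1# − β / (α * cs k * d k))
           * (prodℤ (λ j → (1# − α * a j * cs j) * (1# − β * a j / cs j)) 1ℤ (k -ℤ 1ℤ)
              / prodℤ (λ j → (1# − α * a j * d j) * (1# − β * a j / d j)) 1ℤ k)
           * (prodℤ (λ j → (b j − d j) * (1# − β / (α * b j * d j))) 1ℤ (k -ℤ 1ℤ)
              / prodℤ (λ j → (b j − cs j) * (1# − β / (α * b j * cs j))) 1ℤ k))
    n m
  ≈
  ((prodℤ (λ j → (1# − α * a j * cs j) * (1# − β * a j / cs j)) 1ℤ (+ m)
     / prodℤ (λ j → (1# − α * a j * d j) * (1# − β * a j / d j)) 1ℤ (+ m))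
   * (prodℤ (λ j → (b j − d j) * (1# − β / (α * b j * d j))) 1ℤ (+ m)
     / prodℤ (λ j → (b j − cs j) * (1# − β / (α * b j * cs j))) 1ℤ (+ m))
   −
   (prodℤ (λ j → (1# − α * a j * d j) * (1# − β * a j / d j)) (negℤ (+ n)) 0ℤ
     / prodℤ (λ j → (1# − α * a j * cs j) * (1# − β * a j / cs j)) (negℤ (+ n)) 0ℤ)
   * (prodℤ (λ j → (b j − cs j) * (1# − β / (α * b j * cs j))) (negℤ (+ n)) 0ℤ
     / prodℤ (λ j → (b j − d j) * (1# − β / (α * b j * d j))) (negℤ (+ n)) 0ℤ))
corollary3p5 F α β a b cs d m n α≉0 b≉0 c≉0 d≉0 θc≉0 θd≉0 δbc≉0 δbd≉0 =
  ratio-telescope (λ j → θ α β (a j) (cs j)) (λ j → θ α β (a j) (d j))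
                  (λ j → δ α β (b j) (d j)) (λ j → δ α β (b j) (cs j))
                  n m θc≉0 θd≉0 δbd≉0 δbc≉0 prefactor prefactor≈
  where
  open FieldOps F
  open ThreeTermIdentity F
  open RatioTelescope F

  prefactor : ℤ → Carrier
  prefactor k = θ α β (a k) (b k) * (cs k − d k) * (1# − β / (α * cs k * d k))

  prefactor≈ : OnInterval (λ k → prefactor k ≈ θ α β (a k) (cs k) * δ α β (b k) (d k)
                                               − θ α β (a k) (d k) * δ α β (b k) (cs k))
                          (negℤ (+ n)) (+ m)
  prefactor≈ k _ _ = trans (*-assoc _ _ _) (three-term-identity β (a k) α≉0 (b≉0 k) (c≉0 k) (d≉0 k))
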